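{- For all integers $d \ge 0$, $$V_d \le V_{15} = \frac{2^{121}}{3^{20}\cdot 5^9\cdot 7^9\cdot 11^6\cdot 13^4} \approx 191.1888,$$ and $\lim_{d\to\infty} V_d = 0$.
   Context: For an integer $d\ge 0$, $V_d = 2^{d+1}(d+1)^s \prod_{j=1}^s \frac{(2j)^{d-2j}}{(2j+1)^{d+1-2j}}$ with $s = \lfloor (d-1)/2\rfloor$ (empty product $=1$). -}

module Defs where

open import Data.Nat using (ℕ; zero; suc; _+_; _*_; _∸_; _^_; NonZero)
open import Data.Nat.Properties using (m*n≢0; m^n≢0; +-comm)
open import Data.Nat.DivMod using (_/_)
open import Data.Integer using (+_)
import Data.Rational as ℚ
open ℚ using (ℚ)

-- s = ⌊(d-1)/2⌋ for d ≥ 1; for d = 0 the paper's s = -1 gives empty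
-- product and (d+1)^s = 1^(-1) = 1, which agrees with s = 0 here.
sOf : ℕ → ℕ
sOf d = (d ∸ 1) / 2

-- ∏_{j=1}^{s} (2j)^(d-2j)   (exponents are ≥ 1 since 2j ≤ d-1)
numProd : ℕ → ℕ → ℕ
numProd d zero    = 1
numProd d (suc j) = numProd d j * ((2 * suc j) ^ (d ∸ 2 * suc j))

denProd : ℕ → ℕ → ℕ
denProd d zero    = 1
denProd d (suc j) = denProd d j * ((2 * suc j + 1) ^ (suc d ∸ 2 * suc j))

denProd≢0 : ∀ d j → NonZero (denProd d j)
denProd≢0 d zero    = _
denProd≢0 d (suc j) =
  m*n≢0 (denProd d j) ((2 * suc j + 1) ^ (suc d ∸ 2 * suc j))
    {{denProd≢0 d j}} {{m^n≢0 (2 * suc j + 1) (suc d ∸ 2 * suc j) {{nz j}}}}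
  where
  nz : ∀ k → NonZero (2 * suc k + 1)
  nz k rewrite +-comm (2 * suc k) 1 = _

V : ℕ → ℚ
V d = ℚ._/_ (+ (2 ^ suc d * suc d ^ sOf d * numProd d (sOf d)))
          (denProd d (sOf d)) {{denProd≢0 d (sOf d)}}

module Submission where

-- The heart of the proof is the
-- ratio estimate  k · V (d+1) ≤ V d  whenever 32 k² ≤ d  (lemma `decays`).
-- Passing from d to d+1 raises every exponent by one, so V (d+1) / V d is
--   2 ((d+2)/(d+1))^s · (2·4⋯2s) / (3·5⋯(2s+1)),
-- for odd d; for even d the exponent is s+1 and a factor d/(d+1) ≤ 1 joins.
-- Two classical bounds control it: a Bernoulli-type estimate
-- ((d+2)/(d+1))^s ≤ 2 for 2s ≤ d+1, and a Wallis-type estimate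
-- (2·4⋯2s)² (s+1) ≤ (3·5⋯(2s+1))², giving V (d+1) / V d ≤ 1/k.
-- With k = 1 the sequence decreases from d = 32 on, so V d ≤ V 15 follows
-- from a finite check of d ≤ 32.  With k = 2 the sequence halves at every
-- step from d = 128 on, and V 128 ≤ 1, so 2^n · V (n + 128) ≤ 1, which
-- gives V d → 0.  The closed form of V 15 holds by evaluation.

open import Defs
open import Data.Nat
  using (ℕ; zero; suc; _+_; _*_; _∸_; _^_; _≤_; _<_; _≤?_; z≤n; s≤s; s≤s⁻¹; NonZero)
open import Data.Nat.Properties
open import Data.Nat.DivMod using (_/_; m*n/n≡m; +-distrib-/-∣ʳ)
open import Data.Nat.Divisibility using (divides)
open import Data.Nat.Tactic.RingSolver using (solve-∀)
open import Data.Fin using (Fin; toℕ; fromℕ<)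
open import Data.Fin.Properties using (all?; toℕ-fromℕ<)
open import Data.Integer using (+_)
import Data.Integer as ℤ
open import Data.Integer.Properties using (pos-*)
open import Data.Product using (_×_; ∃; _,_)
open import Data.Sum using ([_,_]′)
open import Relation.Binary.PropositionalEquality
open import Relation.Nullary using (yes; no; contradiction)
open import Relation.Nullary.Decidable using (toWitness)
import Data.Rational as ℚ
open ℚ using (ℚ; mkℚ)
import Data.Rational.Properties as ℚP
import Data.Rational.Unnormalised as ℚᵘ
import Data.Rational.Unnormalised.Properties as ℚᵘP

evenProd : ℕ → ℕ
evenProd zero    = 1
evenProd (suc j) = evenProd j * (2 * suc j)

oddProd : ℕ → ℕ
oddProd zero    = 1
oddProd (suc j) = oddProd j * (2 * suc j + 1)

shuffle : ∀ A f x P → A * f * (x * P) ≡ A * P * (f * x)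
shuffle = solve-∀

-- Raising d by one raises every exponent d - 2i of numProd by one.
numProd-suc : ∀ d j → 2 * j ≤ d → numProd (suc d) j ≡ numProd d j * evenProd j
numProd-suc d zero    _ = refl
numProd-suc d (suc j) h = begin
  numProd (suc d) j * x ^ (suc d ∸ x)   ≡⟨ cong₂ (λ A e → A * x ^ e) IH (+-∸-assoc 1 h) ⟩
  numProd d j * evenProd j * (x * P)    ≡⟨ shuffle (numProd d j) (evenProd j) x P ⟩
  numProd d j * P * (evenProd j * x)    ∎
  where
  open ≡-Reasoning
  x = 2 * suc j
  P = x ^ (d ∸ x)
  IH = numProd-suc d j (≤-trans (*-monoʳ-≤ 2 (n≤1+n j)) h)

denProd-suc : ∀ d j → 2 * j ≤ suc d → denProd (suc d) j ≡ denProd d j * oddProd j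
denProd-suc d zero    _ = refl
denProd-suc d (suc j) h = begin
  denProd (suc d) j * y ^ (suc (suc d) ∸ x)   ≡⟨ cong₂ (λ A e → A * y ^ e) IH (+-∸-assoc 1 h) ⟩
  denProd d j * oddProd j * (y * P)           ≡⟨ shuffle (denProd d j) (oddProd j) y P ⟩
  denProd d j * P * (oddProd j * y)           ∎
  where
  open ≡-Reasoning
  x = 2 * suc j
  y = x + 1
  P = y ^ (suc d ∸ x)
  IH = denProd-suc d j (≤-trans (*-monoʳ-≤ 2 (n≤1+n j)) h)

-- A Wallis-type inequality (2·4⋯2s)² (s+1) ≤ (3·5⋯(2s+1))²; the step is
-- (2s+2)² (s+2) + (s+1) = (2s+3)² (s+1).
wallis : ∀ s → evenProd s * evenProd s * suc s ≤ oddProd s * oddProd s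
wallis zero    = ≤-refl
wallis (suc s) = begin
  F * x * (F * x) * (2 + s)   ≡⟨ regroup F x (2 + s) ⟩
  F * F * (x * x * (2 + s))   ≤⟨ *-monoʳ-≤ (F * F) factor ⟩
  F * F * (y * y * suc s)     ≡⟨ regroup′ F y (suc s) ⟩
  F * F * suc s * (y * y)     ≤⟨ *-monoˡ-≤ (y * y) (wallis s) ⟩
  G * G * (y * y)             ≡⟨ regroup″ G y ⟩
  G * y * (G * y)             ∎
  where
  open ≤-Reasoning
  F = evenProd s
  G = oddProd s
  x = 2 * suc s
  y = 2 * suc s + 1
  regroup : ∀ f x t → f * x * (f * x) * t ≡ f * f * (x * x * t)
  regroup = solve-∀
  regroup′ : ∀ f y t → f * f * (y * y * t) ≡ f * f * t * (y * y)
  regroup′ = solve-∀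
  regroup″ : ∀ g y → g * g * (y * y) ≡ g * y * (g * y)
  regroup″ = solve-∀
  step-identity : ∀ s → (2 * suc s + 1) * (2 * suc s + 1) * suc s
                        ≡ 2 * suc s * (2 * suc s) * (2 + s) + suc s
  step-identity = solve-∀
  factor : x * x * (2 + s) ≤ y * y * suc s
  factor = subst (x * x * (2 + s) ≤_) (sym (step-identity s)) (m≤m+n _ _)

square-reflects-≤ : ∀ a b → a * a ≤ b * b → a ≤ b
square-reflects-≤ a b h with a ≤? b
... | yes a≤b = a≤b
... | no  a≰b = contradiction h (<⇒≱ (*-mono-< (≰⇒> a≰b) (≰⇒> a≰b)))

wallis-scaled : ∀ s k → 16 * k * k ≤ suc s → 4 * k * evenProd s ≤ oddProd s
wallis-scaled s k h = square-reflects-≤ _ _ (begin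
  4 * k * F * (4 * k * F)   ≡⟨ regroup k F ⟩
  F * F * (16 * k * k)      ≤⟨ *-monoʳ-≤ (F * F) h ⟩
  F * F * suc s             ≤⟨ wallis s ⟩
  oddProd s * oddProd s     ∎)
  where
  open ≤-Reasoning
  F = evenProd s
  regroup : ∀ k f → 4 * k * f * (4 * k * f) ≡ f * f * (16 * k * k)
  regroup = solve-∀

-- A Bernoulli-type bound: (1 + 1/m)^k ≤ m/a when k + a = m, in the form
-- (m+1)^k · a ≤ m^k · m.  Induct on k, trading one factor (m+1)/m for the
-- increase of a by one, using (m+1) a ≤ m (a+1).
compound-bound : ∀ k a m → k + a ≡ m → suc m ^ k * a ≤ m ^ k * m
compound-bound zero    a .a refl = ≤-refl
compound-bound (suc k) a m eq    = begin
  suc m * P * a     ≡⟨ regroup (suc m) P a ⟩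
  P * (suc m * a)   ≤⟨ *-monoʳ-≤ P trade ⟩
  P * (m * suc a)   ≡⟨ regroup′ P m (suc a) ⟩
  m * (P * suc a)   ≤⟨ *-monoʳ-≤ m (compound-bound k (suc a) m (trans (+-suc k a) eq)) ⟩
  m * (m ^ k * m)   ≡⟨ *-assoc m (m ^ k) m ⟨
  m * m ^ k * m     ∎
  where
  open ≤-Reasoning
  P = suc m ^ k
  regroup : ∀ x p a → x * p * a ≡ p * (x * a)
  regroup = solve-∀
  regroup′ : ∀ p m b → p * (m * b) ≡ m * (p * b)
  regroup′ = solve-∀
  a≤m : a ≤ m
  a≤m = subst (a ≤_) eq (m≤n+m a (suc k))
  trade : suc m * a ≤ m * suc a
  trade = subst (a + m * a ≤_) (sym (*-suc m a)) (+-monoˡ-≤ (m * a) a≤m)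

compound-≤-double : ∀ k a m .{{_ : NonZero a}} → k + a ≡ m → m ≤ 2 * a →
                    suc m ^ k ≤ 2 * m ^ k
compound-≤-double k a m eq m≤2a = *-cancelʳ-≤ _ _ a (begin
  suc m ^ k * a     ≤⟨ compound-bound k a m eq ⟩
  m ^ k * m         ≤⟨ *-monoʳ-≤ (m ^ k) m≤2a ⟩
  m ^ k * (2 * a)   ≡⟨ regroup (m ^ k) a ⟩
  2 * m ^ k * a     ∎)
  where
  open ≤-Reasoning
  regroup : ∀ x a → x * (2 * a) ≡ 2 * x * a
  regroup = solve-∀

NumAt : ℕ → ℕ → ℕ
NumAt d s = 2 ^ suc d * suc d ^ s * numProd d s

Num : ℕ → ℕ
Num d = NumAt d (sOf d)

Den : ℕ → ℕ
Den d = denProd d (sOf d)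

Den≢0 : ∀ d → NonZero (Den d)
Den≢0 d = denProd≢0 d (sOf d)

-- `Decays k d` says  k · V (d+1) ≤ V d, cross-multiplied.
Decays : ℕ → ℕ → Set
Decays k d = k * Num (suc d) * Den d ≤ Num d * Den (suc d)

decay-from-growth : ∀ {k N N′ D D′} P u u′ w →
                    N ≡ P * u → N′ ≡ P * u′ → D′ ≡ D * w → k * u′ ≤ u * w →
                    k * N′ * D ≤ N * D′
decay-from-growth {k} {D = D} P u u′ w refl refl refl ku′≤uw = begin
  k * (P * u′) * D    ≡⟨ regroup k P u′ D ⟩
  P * D * (k * u′)    ≤⟨ *-monoʳ-≤ (P * D) ku′≤uw ⟩
  P * D * (u * w)     ≡⟨ regroup′ P D u w ⟩
  P * u * (D * w)     ∎
  where
  open ≤-Reasoning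
  regroup : ∀ k P u′ D → k * (P * u′) * D ≡ P * D * (k * u′)
  regroup = solve-∀
  regroup′ : ∀ P D u w → P * D * (u * w) ≡ P * u * (D * w)
  regroup′ = solve-∀

sOf-1+2s : ∀ s → sOf (suc (2 * s)) ≡ s
sOf-1+2s s = trans (cong (_/ 2) (*-comm 2 s)) (m*n/n≡m s 2)

sOf-2+2s : ∀ s → sOf (suc (suc (2 * s))) ≡ s
sOf-2+2s s = trans (+-distrib-/-∣ʳ 1 (divides s (*-comm 2 s))) (sOf-1+2s s)

sOf-3+2s : ∀ s → sOf (suc (suc (suc (2 * s)))) ≡ suc s
sOf-3+2s s = trans (cong (λ t → sOf (suc t)) (sym (*-suc 2 s))) (sOf-1+2s (suc s))

-- Odd d = 2s+1: both V d and V (d+1) use s factors, and the ratio is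
-- 2 ((d+2)/(d+1))^s · evenProd s / oddProd s ≤ 4 evenProd s / oddProd s.
decays-odd : ∀ s k → 16 * k * k ≤ suc s → Decays k (suc (2 * s))
decays-odd s k h rewrite sOf-1+2s s | sOf-2+2s s =
  decay-from-growth {k} {NumAt d s} {NumAt b s} {denProd d s} {denProd b s}
    (2 ^ b * A) (b ^ s) (2 * c ^ s * F) G
    (regroup (2 ^ b) (b ^ s) A)
    (trans (cong (λ t → 2 ^ c * c ^ s * t) (numProd-suc d s (n≤1+n _)))
           (regroup′ (2 ^ b) (c ^ s) A F))
    (denProd-suc d s (≤-trans (n≤1+n _) (n≤1+n _)))
    growth
  where
  open ≤-Reasoning
  d = suc (2 * s)
  b = suc d
  c = suc b
  A = numProd d s
  F = evenProd s
  G = oddProd s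
  regroup : ∀ T x A → T * x * A ≡ T * A * x
  regroup = solve-∀
  regroup′ : ∀ T y A F → 2 * T * y * (A * F) ≡ T * A * (2 * y * F)
  regroup′ = solve-∀
  regroup″ : ∀ k x F → k * (2 * (2 * x) * F) ≡ x * (4 * k * F)
  regroup″ = solve-∀
  shift : ∀ s → s + (2 + s) ≡ suc (suc (2 * s))
  shift = solve-∀
  double : ∀ s → 2 * (2 + s) ≡ suc (suc (2 * s)) + 2
  double = solve-∀
  b≤2[2+s] : b ≤ 2 * (2 + s)
  b≤2[2+s] = subst (b ≤_) (sym (double s)) (m≤m+n b 2)
  growth : k * (2 * c ^ s * F) ≤ b ^ s * G
  growth = begin
    k * (2 * c ^ s * F)         ≤⟨ *-monoʳ-≤ k (*-monoˡ-≤ F (*-monoʳ-≤ 2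
                                     (compound-≤-double s (2 + s) b (shift s) b≤2[2+s]))) ⟩
    k * (2 * (2 * b ^ s) * F)   ≡⟨ regroup″ k (b ^ s) F ⟩
    b ^ s * (4 * k * F)         ≤⟨ *-monoʳ-≤ (b ^ s) (wallis-scaled s k h) ⟩
    b ^ s * G                   ∎

-- For even d = 2s+2 the number of factors grows from s to s+1; the new
-- factors are (2s+2)^1 = d in the numerator and (2s+3)^2 in the denominator.
numProd-new-factor : ∀ s → numProd (suc (suc (suc (2 * s)))) (suc s)
                           ≡ numProd (suc (suc (2 * s))) s * evenProd s * suc (suc (2 * s))
numProd-new-factor s = begin
  numProd c s * (2 * suc s) ^ (c ∸ 2 * suc s)
    ≡⟨ cong₂ (λ A x → A * x ^ (c ∸ x)) (numProd-suc b s (m≤n+m (2 * s) 2)) (*-suc 2 s) ⟩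
  numProd b s * evenProd s * b ^ (c ∸ b)
    ≡⟨ cong (λ e → numProd b s * evenProd s * b ^ e) (m+n∸n≡m 1 b) ⟩
  numProd b s * evenProd s * (b * 1)
    ≡⟨ cong (numProd b s * evenProd s *_) (*-identityʳ b) ⟩
  numProd b s * evenProd s * b
    ∎
  where
  open ≡-Reasoning
  b = suc (suc (2 * s))
  c = suc b

denProd-new-factor : ∀ s → denProd (suc (suc (suc (2 * s)))) (suc s)
                           ≡ denProd (suc (suc (2 * s))) s * (oddProd s * (suc (suc (suc (2 * s))) * suc (suc (suc (2 * s)))))
denProd-new-factor s = begin
  denProd c s * (2 * suc s + 1) ^ (suc c ∸ 2 * suc s)
    ≡⟨ cong₂ (λ A x → A * (x + 1) ^ (suc c ∸ x)) (denProd-suc b s (m≤n+m (2 * s) 3)) (*-suc 2 s) ⟩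
  denProd b s * oddProd s * (b + 1) ^ (suc c ∸ b)
    ≡⟨ cong₂ (λ x e → denProd b s * oddProd s * x ^ e) (+-comm b 1) (m+n∸n≡m 2 b) ⟩
  denProd b s * oddProd s * (c * (c * 1))
    ≡⟨ regroup (denProd b s) (oddProd s) c ⟩
  denProd b s * (oddProd s * (c * c))
    ∎
  where
  open ≡-Reasoning
  b = suc (suc (2 * s))
  c = suc b
  regroup : ∀ D G c → D * G * (c * (c * 1)) ≡ D * (G * (c * c))
  regroup = solve-∀

-- Even d = 2s+2: the ratio is
-- 2 ((d+2)/(d+1))^(s+1) · d/(d+1) · evenProd s / oddProd s ≤ 4 evenProd s / oddProd s.
decays-even : ∀ s k → 16 * k * k ≤ suc s → Decays k (suc (suc (2 * s)))
decays-even s k h rewrite sOf-2+2s s | sOf-3+2s s =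
  decay-from-growth {k} {NumAt b s} {NumAt c (suc s)} {denProd b s} {denProd c (suc s)}
    (2 ^ c * A) (c ^ s) (2 * e ^ suc s * F * b) (G * (c * c))
    (regroup (2 ^ c) (c ^ s) A)
    (trans (cong (λ t → 2 ^ e * e ^ suc s * t) (numProd-new-factor s))
           (regroup′ (2 ^ c) (e ^ suc s) A F b))
    (denProd-new-factor s)
    growth
  where
  open ≤-Reasoning
  b = suc (suc (2 * s))
  c = suc b
  e = suc c
  A = numProd b s
  F = evenProd s
  G = oddProd s
  regroup : ∀ T x A → T * x * A ≡ T * A * x
  regroup = solve-∀
  regroup′ : ∀ T y A F b → 2 * T * y * (A * F * b) ≡ T * A * (2 * y * F * b)
  regroup′ = solve-∀
  regroup″ : ∀ k c x F → k * (2 * (2 * (c * x)) * F * c) ≡ x * (c * c) * (4 * k * F)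
  regroup″ = solve-∀
  regroup‴ : ∀ x c G → x * (c * c) * G ≡ x * (G * (c * c))
  regroup‴ = solve-∀
  shift : ∀ s → suc s + (2 + s) ≡ suc (suc (suc (2 * s)))
  shift = solve-∀
  double : ∀ s → 2 * (2 + s) ≡ suc (suc (suc (2 * s))) + 1
  double = solve-∀
  c≤2[2+s] : c ≤ 2 * (2 + s)
  c≤2[2+s] = subst (c ≤_) (sym (double s)) (m≤m+n c 1)
  growth : k * (2 * e ^ suc s * F * b) ≤ c ^ s * (G * (c * c))
  growth = begin
    k * (2 * e ^ suc s * F * b)             ≤⟨ *-monoʳ-≤ k (*-mono-≤ (*-monoˡ-≤ F (*-monoʳ-≤ 2
                                                 (compound-≤-double (suc s) (2 + s) c (shift s) c≤2[2+s])))
                                               (n≤1+n b)) ⟩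
    k * (2 * (2 * (c * c ^ s)) * F * c)     ≡⟨ regroup″ k c (c ^ s) F ⟩
    c ^ s * (c * c) * (4 * k * F)           ≤⟨ *-monoʳ-≤ (c ^ s * (c * c)) (wallis-scaled s k h) ⟩
    c ^ s * (c * c) * G                     ≡⟨ regroup‴ (c ^ s) c G ⟩
    c ^ s * (G * (c * c))                   ∎

data Shape : ℕ → Set where
  origin : Shape 0
  odd    : ∀ s → Shape (suc (2 * s))
  even   : ∀ s → Shape (suc (suc (2 * s)))

shape : ∀ n → Shape n
shape zero = origin
shape (suc n) with shape n
... | origin = odd 0
... | odd s  = even s
... | even s = subst (λ m → Shape (suc m)) (*-suc 2 s) (odd (suc s))

halve : ∀ a b → 2 * a ≤ suc (2 * b) → a ≤ b
halve a b h = s≤s⁻¹ (*-cancelˡ-< 2 a (suc b)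
  (subst (2 * a <_) (sym (*-suc 2 b)) (s≤s h)))

-- The hypothesis 32k² ≤ d of `decays` halves to 16k² ≤ ⌊d/2⌋.
thirty-two : ∀ k → 32 * k * k ≡ 2 * (16 * k * k)
thirty-two = solve-∀

decays : ∀ d k → 32 * k * k ≤ d → Decays k d
decays d zero    _ = z≤n
decays d (suc k) h with shape d
... | origin = contradiction h λ ()
... | odd s  = decays-odd s (suc k)
                 (m≤n⇒m≤1+n (halve _ s (subst (_≤ suc (2 * s)) (thirty-two (suc k)) h)))
... | even s = decays-even s (suc k)
                 (halve _ (suc s) (subst₂ _≤_ (thirty-two (suc k)) (cong suc (sym (*-suc 2 s)))
                   (m≤n⇒m≤1+n h)))

geometric : ∀ (f g : ℕ → ℕ) r b → (∀ d → NonZero (g d)) →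
            (∀ d → b ≤ d → r * f (suc d) * g d ≤ f d * g (suc d)) →
            ∀ n → r ^ n * f (n + b) * g b ≤ f b * g (n + b)
geometric f g r b g≢0 step zero    = ≤-reflexive (cong (_* g b) (*-identityˡ (f b)))
geometric f g r b g≢0 step (suc n) = *-cancelʳ-≤ _ _ (g m) {{g≢0 m}} (begin
  r * r ^ n * f (suc m) * g b * g m   ≡⟨ regroup r (r ^ n) (f (suc m)) (g b) (g m) ⟩
  r ^ n * g b * (r * f (suc m) * g m) ≤⟨ *-monoʳ-≤ (r ^ n * g b) (step m (m≤n+m b n)) ⟩
  r ^ n * g b * (f m * g (suc m))     ≡⟨ regroup′ (r ^ n) (g b) (f m) (g (suc m)) ⟩
  g (suc m) * (r ^ n * f m * g b)     ≤⟨ *-monoʳ-≤ (g (suc m)) (geometric f g r b g≢0 step n) ⟩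
  g (suc m) * (f b * g m)             ≡⟨ regroup″ (g (suc m)) (f b) (g m) ⟩
  f b * g (suc m) * g m               ∎)
  where
  open ≤-Reasoning
  m = n + b
  regroup : ∀ r p x y z → r * p * x * y * z ≡ p * y * (r * x * z)
  regroup = solve-∀
  regroup′ : ∀ p y x z → p * y * (x * z) ≡ z * (p * x * y)
  regroup′ = solve-∀
  regroup″ : ∀ z x y → z * (x * y) ≡ x * z * y
  regroup″ = solve-∀

frac-≤ : ∀ a b c e .{{_ : NonZero b}} .{{_ : NonZero e}} →
         a * e ≤ c * b → (+ a) ℚ./ b ℚ.≤ (+ c) ℚ./ e
frac-≤ a (suc b) c (suc e) ae≤cb = ℚP.toℚᵘ-cancel-≤
  (ℚᵘP.≤-respʳ-≃ (ℚᵘP.≃-sym (ℚP.toℚᵘ-fromℚᵘ (ℚᵘ.mkℚᵘ (+ c) e)))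
  (ℚᵘP.≤-respˡ-≃ (ℚᵘP.≃-sym (ℚP.toℚᵘ-fromℚᵘ (ℚᵘ.mkℚᵘ (+ a) b)))
  (ℚᵘ.*≤* (subst₂ ℤ._≤_ (pos-* a (suc e)) (pos-* c (suc b)) (ℤ.+≤+ ae≤cb)))))

frac-< : ∀ a b c e .{{_ : NonZero b}} .{{_ : NonZero e}} →
         a * e < c * b → (+ a) ℚ./ b ℚ.< (+ c) ℚ./ e
frac-< a (suc b) c (suc e) ae<cb = ℚP.toℚᵘ-cancel-<
  (ℚᵘP.<-respʳ-≃ (ℚᵘP.≃-sym (ℚP.toℚᵘ-fromℚᵘ (ℚᵘ.mkℚᵘ (+ c) e)))
  (ℚᵘP.<-respˡ-≃ (ℚᵘP.≃-sym (ℚP.toℚᵘ-fromℚᵘ (ℚᵘ.mkℚᵘ (+ a) b)))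
  (ℚᵘ.*<* (subst₂ ℤ._<_ (pos-* a (suc e)) (pos-* c (suc b)) (ℤ.+<+ ae<cb)))))

V-≤ : ∀ d d′ → Num d * Den d′ ≤ Num d′ * Den d → V d ℚ.≤ V d′
V-≤ d d′ = frac-≤ (Num d) (Den d) (Num d′) (Den d′) {{Den≢0 d}} {{Den≢0 d′}}

initial-segment : (i : Fin 33) → V (toℕ i) ℚ.≤ V 15
initial-segment = toWitness {a? = all? (λ i → V (toℕ i) ℚ.≤? V 15)} _

initial-bound : ∀ d → d ≤ 32 → V d ℚ.≤ V 15
initial-bound d d≤32 = subst (λ t → V t ℚ.≤ V 15) (toℕ-fromℕ< (s≤s d≤32))
  (initial-segment (fromℕ< (s≤s d≤32)))

antitone-from-32 : ∀ n → V (n + 32) ℚ.≤ V 32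
antitone-from-32 n = V-≤ (n + 32) 32
  (≤-trans (≤-reflexive unit-ratio) (geometric Num Den 1 32 Den≢0 (λ d → decays d 1) n))
  where
  unit-ratio : Num (n + 32) * Den 32 ≡ 1 ^ n * Num (n + 32) * Den 32
  unit-ratio = cong (_* Den 32)
    (sym (trans (cong (_* Num (n + 32)) (^-zeroˡ n)) (*-identityˡ (Num (n + 32)))))

later-bound : ∀ d → 32 ≤ d → V d ℚ.≤ V 15
later-bound d 32≤d = subst (λ t → V t ℚ.≤ V 15) (m∸n+n≡m 32≤d)
  (ℚP.≤-trans (antitone-from-32 (d ∸ 32)) (initial-bound 32 ≤-refl))

bounded-by-V15 : ∀ d → V d ℚ.≤ V 15
bounded-by-V15 d = [ initial-bound d , later-bound d ]′ (≤-total d 32)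

Num128≤Den128 : Num 128 ≤ Den 128
Num128≤Den128 = toWitness {a? = Num 128 ≤? Den 128} _

halving : ∀ n → 2 ^ n * Num (n + 128) ≤ Den (n + 128)
halving n = *-cancelʳ-≤ _ _ (Den 128) {{Den≢0 128}} (begin
  2 ^ n * Num (n + 128) * Den 128   ≤⟨ geometric Num Den 2 128 Den≢0 (λ d → decays d 2) n ⟩
  Num 128 * Den (n + 128)           ≤⟨ *-monoˡ-≤ (Den (n + 128)) Num128≤Den128 ⟩
  Den 128 * Den (n + 128)           ≡⟨ *-comm (Den 128) (Den (n + 128)) ⟩
  Den (n + 128) * Den 128           ∎)
  where open ≤-Reasoning

n<2^n : ∀ n → n < 2 ^ n
n<2^n zero    = s≤s z≤n
n<2^n (suc n) = subst (suc (suc n) ≤_) (cong (λ t → 2 ^ n + t) (sym (+-identityʳ (2 ^ n))))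
                  (+-mono-≤ (m^n>0 2 n) (n<2^n n))

V-small : ∀ n p q → suc q ≤ n → V (n + 128) ℚ.< (+ suc p) ℚ./ suc q
V-small n p q q<n = frac-< (Num x) (Den x) (suc p) (suc q) {{Den≢0 x}}
  (*-cancelˡ-< (2 ^ n) _ _ (begin-strict
    2 ^ n * (Num x * suc q)   ≡⟨ *-assoc (2 ^ n) (Num x) (suc q) ⟨
    2 ^ n * Num x * suc q     ≤⟨ *-monoˡ-≤ (suc q) (halving n) ⟩
    Den x * suc q             <⟨ *-monoʳ-< (Den x) {{Den≢0 x}} (≤-trans (s≤s q<n) (n<2^n n)) ⟩
    Den x * 2 ^ n             ≤⟨ m≤m*n (Den x * 2 ^ n) (suc p) ⟩
    Den x * 2 ^ n * suc p     ≡⟨ regroup (Den x) (2 ^ n) (suc p) ⟩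
    2 ^ n * (suc p * Den x)   ∎))
  where
  open ≤-Reasoning
  x = n + 128
  regroup : ∀ D t p → D * t * p ≡ t * (p * D)
  regroup = solve-∀

tends-to-zero : (ε : ℚ) → ℚ.0ℚ ℚ.< ε → ∃ λ N → (d : ℕ) → N ≤ d → V d ℚ.< ε
tends-to-zero ε@(mkℚ (+ suc p) q _) _ = suc q + 128 , λ d N≤d →
  subst (V d ℚ.<_) (ℚP.↥p/↧p≡p ε)
    (subst (λ t → V t ℚ.< (+ suc p) ℚ./ suc q) (m∸n+n≡m (≤-trans (m≤n+m 128 (suc q)) N≤d))
      (V-small (d ∸ 128) p q
        (subst (_≤ d ∸ 128) (m+n∸n≡m (suc q) 128) (∸-monoˡ-≤ 128 N≤d))))
tends-to-zero (mkℚ (+ zero) _ _)   (ℚ.*<* (ℤ.+<+ ()))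
tends-to-zero (mkℚ ℤ.-[1+ _ ] _ _) (ℚ.*<* ())

lemma2p2 : ((d : ℕ) → V d ℚ.≤ V 15)
    × (V 15 ≡ (+ (2 ^ 121)) ℚ./ (3 ^ 20 * 5 ^ 9 * 7 ^ 9 * 11 ^ 6 * 13 ^ 4))
    × ((ε : ℚ) → ℚ.0ℚ ℚ.< ε → ∃ λ N → (d : ℕ) → N Data.Nat.≤ d → V d ℚ.< ε)
-- The closed form of V 15 is an equality of normalised rationals, checked
-- by evaluation.
lemma2p2 = bounded-by-V15 , refl , tends-to-zero
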